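{- Let $\Pi=(D;<_1,<_2)$ be the random permutation, let ${\mathscr G}$ be a closed permutation group on $D$ with $\operatorname{Aut}(\Pi)\subseteq{\mathscr G}$, and let $g\colon D\to D$ be a canonical function from $\Pi$ to $\Pi$ which is mon-generated by ${\mathscr G}$. Then either the image $g[D]$ is a diagonal set and $\operatorname{Aut}(D;<_i)\subseteq{\mathscr G}$ for some $i\in\{1,2\}$, or $g$ behaves like one of the following eight functions: $\mathrm{id}$; $(\mathrm{id},\mathrm{rev})$; $(\mathrm{rev},\mathrm{id})$; $(\mathrm{rev},\mathrm{rev})$; $\mathrm{sw}$; $\mathrm{sw}\circ(\mathrm{rev},\mathrm{rev})$; $\mathrm{sw}\circ(\mathrm{id},\mathrm{rev})$; $\mathrm{sw}\circ(\mathrm{rev},\mathrm{id})$.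
   Context: The random permutation $\Pi=(D;<_1,<_2)$ is the countable homogeneous structure with two linear orders $<_1,<_2$ on $D$ (the Fraïssé limit of all finite sets equipped with two linear orders); it is $\omega$-categorical. $\operatorname{Aut}(D;<_i)$ is the group of permutations of $D$ preserving $<_i$. A permutation group on $D$ is closed if it is closed in the topology of pointwise convergence on the symmetric group of $D$. A function $f\colon D\to D$ is mon-generated by a set $F$ of functions if for every finite $A\subseteq D$ some composition of functions from $F$ agrees with $f$ on $A$. The type of a pair $(x,y)$ of distinct elements in $\Pi$ is determined by whether $x<_1y$ and whether $x<_2y$. A function $g\colon D\to D$ is canonical from $\Pi$ to $\Pi$ if for all pairs $(x,y),(x',y')$ having the same type in $\Pi$, the pairs $(g(x),g(y))$ and $(g(x'),g(y'))$ have the same type in $\Pi$. Define $\mathrm{up}(x,y)\iff x<_1y\wedge x<_2y$; $\mathrm{st}(x,y)\iff \mathrm{up}(x,y)\vee\mathrm{up}(y,x)$; $\mathrm{tw}(x,y)\iff\neg\mathrm{st}(x,y)$. A set $S\subseteq D$ is diagonal if either $\mathrm{st}(x,y)$ for all distinct $x,y\in S$, or $\mathrm{tw}(x,y)$ for all distinct $x,y\in S$. For $a,b\in\{\mathrm{id},\mathrm{rev}\}$, $g$ behaves like $(a,b)$ if for all $x,y\in D$: $x<_1y$ implies $g(x)<_1g(y)$ when $a=\mathrm{id}$ and $g(y)<_1g(x)$ when $a=\mathrm{rev}$, and $x<_2y$ implies $g(x)<_2g(y)$ when $b=\mathrm{id}$ and $g(y)<_2g(x)$ when $b=\mathrm{rev}$;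 "behaves like $\mathrm{id}$" means behaves like $(\mathrm{id},\mathrm{id})$. $g$ behaves like $\mathrm{sw}\circ(a,b)$ if for all $x,y$: $x<_1y$ implies $g(x)<_2g(y)$ when $a=\mathrm{id}$ and $g(y)<_2g(x)$ when $a=\mathrm{rev}$, and $x<_2y$ implies $g(x)<_1g(y)$ when $b=\mathrm{id}$ and $g(y)<_1g(x)$ when $b=\mathrm{rev}$; "behaves like $\mathrm{sw}$" means behaves like $\mathrm{sw}\circ(\mathrm{id},\mathrm{id})$. -}

module Defs where

open import Level using (0ℓ)
open import Data.Nat using (ℕ)
open import Data.Product using (Σ; ∃; _×_; _,_)
open import Data.Sum using (_⊎_)
open import Data.List using (List; []; _∷_; foldr)
open import Data.List.Relation.Unary.All using (All)
open import Data.List.Membership.Propositional using (_∈_)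
open import Relation.Nullary using (¬_)
open import Relation.Binary using (Rel; IsStrictTotalOrder)
open import Relation.Binary.PropositionalEquality using (_≡_)
open import Function using (_∘_; id; Surjective)
open import Function.Bundles using (_↔_; Inverse; _⇔_)
open import Function.Construct.Symmetry using (↔-sym)

-- The random permutation Π = (D; <₁, <₂), characterised (among countable
-- structures, up to isomorphism) by: two strict linear orders, countable
-- (a surjection from ℕ), and the extension property of the Fraïssé limit:
-- for finite A, B, C, E with A <₁ B and C <₂ E there is x with
-- A <₁ x <₁ B and C <₂ x <₂ E.
record RandomPermutation : Set₁ where
  field
    D    : Set
    _<₁_ : Rel D 0ℓ
    _<₂_ : Rel D 0ℓ
    isSTO₁ : IsStrictTotalOrder _≡_ _<₁_
    isSTO₂ : IsStrictTotalOrder _≡_ _<₂_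
    enum : ℕ → D
    enum-surj : ∀ (d : D) → ∃ λ n → enum n ≡ d
    extension : ∀ (A B C E : List D) →
      (∀ {a b} → a ∈ A → b ∈ B → a <₁ b) →
      (∀ {c e} → c ∈ C → e ∈ E → c <₂ e) →
      ∃ λ x → All (_<₁ x) A × All (x <₁_) B × All (_<₂ x) C × All (x <₂_) E

data Dir : Set where
  idD revD : Dir

module _ (Π : RandomPermutation) where
  open RandomPermutation Π

  Perm : Set
  Perm = D ↔ D

  app : Perm → D → D
  app = Inverse.to

  Preserves : Rel D 0ℓ → Perm → Set
  Preserves R π = ∀ x y → R x y ⇔ R (app π x) (app π y)

  AutΠ : Perm → Set
  AutΠ π = Preserves _<₁_ π × Preserves _<₂_ π

  AutSubset : Rel D 0ℓ → (Perm → Set) → Set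
  AutSubset R G = ∀ π → Preserves R π → G π

  AgreeOn : List D → (D → D) → (D → D) → Set
  AgreeOn A f h = All (λ a → f a ≡ h a) A

  -- 𝒢 is a permutation group (closed under identity, composition, inverse)
  -- which is closed in the topology of pointwise convergence.
  record IsClosedPermGroup (G : Perm → Set) : Set where
    field
      id-∈   : ∀ π → (∀ x → app π x ≡ x) → G π
      comp-∈ : ∀ π σ τ → G σ → G τ → (∀ x → app π x ≡ app σ (app τ x)) → G π
      inv-∈  : ∀ σ → G σ → G (↔-sym σ)
      closed : ∀ π → (∀ (A : List D) → ∃ λ σ → G σ × AgreeOn A (app π) (app σ)) → G π

  compose : List Perm → D → D
  compose = foldr (λ σ h → app σ ∘ h) id

  MonGenerated : (Perm → Set) → (D → D) → Set
  MonGenerated G f = ∀ (A : List D) → ∃ λ (σs : List Perm) → All G σs × AgreeOn A f (compose σs)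

  SameType : D → D → D → D → Set
  SameType x y x' y' = (x ≡ y ⇔ x' ≡ y') × (x <₁ y ⇔ x' <₁ y') × (x <₂ y ⇔ x' <₂ y')

  Canonical : (D → D) → Set
  Canonical g = ∀ x y x' y' → SameType x y x' y' → SameType (g x) (g y) (g x') (g y')

  up st tw : D → D → Set
  up x y = x <₁ y × x <₂ y
  st x y = up x y ⊎ up y x
  tw x y = ¬ st x y

  DiagonalImage : (D → D) → Set
  DiagonalImage g = (∀ a b → ¬ g a ≡ g b → st (g a) (g b))
                  ⊎ (∀ a b → ¬ g a ≡ g b → tw (g a) (g b))

  Maps : Dir → Rel D 0ℓ → Rel D 0ℓ → (D → D) → Set
  Maps idD  R S g = ∀ x y → R x y → S (g x) (g y)
  Maps revD R S g = ∀ x y → R x y → S (g y) (g x)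

  BehavesLike : Dir → Dir → (D → D) → Set
  BehavesLike a b g = Maps a _<₁_ _<₁_ g × Maps b _<₂_ _<₂_ g

  BehavesLikeSw : Dir → Dir → (D → D) → Set
  BehavesLikeSw a b g = Maps a _<₁_ _<₂_ g × Maps b _<₂_ _<₁_ g

-- Being locally a permutation from 𝒢, g is injective. By canonicity the orientation of each
-- order <ⱼ on a pair of g-images depends only on the type of the source pair, and comparing the
-- two types up to reversal (straight and twisted) shows that it is dictated either by the
-- <₁-order or by the <₂-order of the source pair. If the two image orders are dictated by different
-- source orders, g behaves like one of the eight listed functions. If both are dictated by <ᵢ,
-- the image is diagonal; moreover for π ∈ Aut(D;<ᵢ) and finite A the pairs (g a, g (π a)), a ∈ A,
-- form a partial isomorphism of Π, which extends to an automorphism α by back and forth. With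
-- s ∈ 𝒢 agreeing with g on A ∪ π[A], s⁻¹ α s ∈ 𝒢 agrees with π on A, so π ∈ 𝒢 as 𝒢 is closed.
module Submission where

open import Defs
open import Level using (0ℓ)
open import Data.Nat using (ℕ; zero; suc; _+_)
open import Data.Nat.Properties using (+-comm)
open import Data.Product using (Σ; ∃; ∃₂; _×_; _,_; proj₁; proj₂; swap)
open import Data.Sum using (_⊎_; inj₁; inj₂)
open import Data.List using (List; []; _∷_; map; filter; _++_)
open import Data.List.Relation.Unary.All as All using (All; []; _∷_)
open import Data.List.Relation.Unary.Any using (here; there)
open import Data.List.Membership.Propositional using (_∈_)
open import Data.List.Membership.Propositional.Properties
  using (∈-map⁺; ∈-map⁻; ∈-map∘filter⁺; ∈-map∘filter⁻; ∈-++⁺ˡ; ∈-++⁺ʳ)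
open import Data.List.Relation.Binary.Subset.Propositional using (_⊆_)
open import Data.Empty using (⊥-elim)
open import Relation.Nullary using (¬_; Dec; yes; no)
open import Relation.Binary using (Rel; IsStrictTotalOrder; Symmetric; tri<; tri≈; tri>)
open import Relation.Binary.PropositionalEquality
  using (_≡_; _≢_; refl; sym; trans; cong; subst; module ≡-Reasoning)
open import Function using (flip; _∘′_)
open import Function.Bundles using (Inverse; Injection; _⇔_; mk⇔; mk↔ₛ′; Equivalence)
open import Function.Construct.Identity using (↔-id)
open import Function.Construct.Composition using (_↔-∘_)
open import Function.Construct.Symmetry using (↔-sym; ⇔-sym)
open import Function.Properties.Inverse using (↔⇒↣)

flipDir : Dir → Dir
flipDir idD = revD
flipDir revD = idD

orient : ∀ {A : Set} → Dir → Rel A 0ℓ → Rel A 0ℓ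
orient idD R = R
orient revD R = flip R

module _ {A : Set} {R : Rel A 0ℓ} where

  orient-flip : ∀ d {x y} → orient d R y x → orient (flipDir d) R x y
  orient-flip idD r = r
  orient-flip revD r = r

  orient-unflip : ∀ d {x y} → orient (flipDir d) R y x → orient d R x y
  orient-unflip idD r = r
  orient-unflip revD r = r

module Orientation {A : Set} {R : Rel A 0ℓ} (sto : IsStrictTotalOrder _≡_ R) where
  open IsStrictTotalOrder sto

  orient-≢ : ∀ d {x y} → orient d R x y → x ≢ y
  orient-≢ idD r refl = irrefl refl r
  orient-≢ revD r refl = irrefl refl r

  orientation : ∀ {x y} → x ≢ y → ∃ λ d → orient d R x y
  orientation {x} {y} x≢y with compare x y
  ... | tri< x<y _ _ = idD , x<y
  ... | tri≈ _ x≡y _ = ⊥-elim (x≢y x≡y)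
  ... | tri> _ _ y<x = revD , y<x

  orient-⇔ : ∀ d {x y x' y'} → orient d R x y → orient d R x' y' → R x y ⇔ R x' y'
  orient-⇔ idD r r' = mk⇔ (λ _ → r') (λ _ → r)
  orient-⇔ revD r r' = mk⇔ (λ r⁻ → ⊥-elim (asym r⁻ r)) (λ r'⁻ → ⊥-elim (asym r'⁻ r'))

  orient-transfer : ∀ d {x y x' y'} → (x ≡ y ⇔ x' ≡ y') → (R x y ⇔ R x' y') →
                    orient d R x' y' → orient d R x y
  orient-transfer idD _ R⇔ r' = Equivalence.from R⇔ r'
  orient-transfer revD {x} {y} ≡⇔ R⇔ r' with compare x y
  ... | tri< x<y _ _ = ⊥-elim (asym r' (Equivalence.to R⇔ x<y))
  ... | tri≈ _ x≡y _ = ⊥-elim (irrefl (sym (Equivalence.to ≡⇔ x≡y)) r')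
  ... | tri> _ _ y<x = y<x

module Homogeneity (Π : RandomPermutation) where
  open RandomPermutation Π

  PartialMap : Set
  PartialMap = List (D × D)

  Respects : Rel D 0ℓ → PartialMap → Set
  Respects R p = ∀ {a b a' b'} → (a , b) ∈ p → (a' , b') ∈ p → R a a' ⇔ R b b'

  IsPartialIso : PartialMap → Set
  IsPartialIso p = Respects _<₁_ p × Respects _<₂_ p

  inverse : PartialMap → PartialMap
  inverse = map swap

  inverse-respects : ∀ {R p} → Respects R p → Respects R (inverse p)
  inverse-respects resp ab∈ ab'∈ with ∈-map⁻ swap ab∈ | ∈-map⁻ swap ab'∈
  ... | _ , ba∈ , refl | _ , ba'∈ , refl = ⇔-sym (resp ba∈ ba'∈)

  inverse-iso : ∀ {p} → IsPartialIso p → IsPartialIso (inverse p)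
  inverse-iso (resp₁ , resp₂) = inverse-respects resp₁ , inverse-respects resp₂

  _∈dom_ : D → PartialMap → Set
  d ∈dom p = ∃ λ b → (d , b) ∈ p

  _∈rng_ : D → PartialMap → Set
  d ∈rng p = ∃ λ a → (a , d) ∈ p

  _∈dom?_ : ∀ d p → Dec (d ∈dom p)
  d ∈dom? [] = no λ ()
  d ∈dom? ((a , b) ∷ p) with IsStrictTotalOrder._≟_ isSTO₁ d a | d ∈dom? p
  ... | yes refl | _ = yes (b , here refl)
  ... | no _ | yes (b' , db'∈) = yes (b' , there db'∈)
  ... | no d≢a | no d∉p = no λ { (_ , here refl) → d≢a refl ; (b' , there db'∈) → d∉p (b' , db'∈) }

  module OneOrder {R : Rel D 0ℓ} (sto : IsStrictTotalOrder _≡_ R) where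
    open IsStrictTotalOrder sto renaming (trans to <-trans)

    respects-functional : ∀ {p a b b'} → Respects R p → (a , b) ∈ p → (a , b') ∈ p → b ≡ b'
    respects-functional {b = b} {b'} resp ab∈ ab'∈ with compare b b'
    ... | tri< b<b' _ _ = ⊥-elim (irrefl refl (Equivalence.from (resp ab∈ ab'∈) b<b'))
    ... | tri≈ _ b≡b' _ = b≡b'
    ... | tri> _ _ b'<b = ⊥-elim (irrefl refl (Equivalence.from (resp ab'∈ ab∈) b'<b))

    respects-injective : ∀ {p a a' b} → Respects R p → (a , b) ∈ p → (a' , b) ∈ p → a ≡ a'
    respects-injective resp ab∈ a'b∈ =
      respects-functional (inverse-respects resp) (∈-map⁺ swap ab∈) (∈-map⁺ swap a'b∈)

    module _ (d : D) where

      imagesBelow imagesAbove : PartialMap → List D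
      imagesBelow p = map proj₂ (filter (λ ab → proj₁ ab <? d) p)
      imagesAbove p = map proj₂ (filter (λ ab → d <? proj₁ ab) p)

      imagesBelow⁻ : ∀ {p b} → b ∈ imagesBelow p → ∃ λ a → (a , b) ∈ p × R a d
      imagesBelow⁻ b∈ with ∈-map∘filter⁻ proj₂ (λ ab → proj₁ ab <? d) b∈
      ... | _ , ab∈ , refl , a<d = _ , ab∈ , a<d

      imagesAbove⁻ : ∀ {p b} → b ∈ imagesAbove p → ∃ λ a → (a , b) ∈ p × R d a
      imagesAbove⁻ b∈ with ∈-map∘filter⁻ proj₂ (λ ab → d <? proj₁ ab) b∈
      ... | _ , ab∈ , refl , d<a = _ , ab∈ , d<a

      imagesBelow⁺ : ∀ {p a b} → (a , b) ∈ p → R a d → b ∈ imagesBelow p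
      imagesBelow⁺ ab∈ a<d = ∈-map∘filter⁺ proj₂ (λ ab → proj₁ ab <? d) (_ , ab∈ , refl , a<d)

      imagesAbove⁺ : ∀ {p a b} → (a , b) ∈ p → R d a → b ∈ imagesAbove p
      imagesAbove⁺ ab∈ d<a = ∈-map∘filter⁺ proj₂ (λ ab → d <? proj₁ ab) (_ , ab∈ , refl , d<a)

      images-separated : ∀ {p} → Respects R p →
                         ∀ {b b'} → b ∈ imagesBelow p → b' ∈ imagesAbove p → R b b'
      images-separated resp b∈ b'∈ with imagesBelow⁻ b∈ | imagesAbove⁻ b'∈
      ... | _ , ab∈ , a<d | _ , a'b'∈ , d<a' = Equivalence.to (resp ab∈ a'b'∈) (<-trans a<d d<a')

      module _ {p : PartialMap} (resp : Respects R p) (d∉p : ¬ d ∈dom p) {e : D}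
               (below<e : All (λ b → R b e) (imagesBelow p)) (e<above : All (R e) (imagesAbove p)) where

        new-pair-respects : ∀ {a b} → (a , b) ∈ p → (R d a ⇔ R e b) × (R a d ⇔ R b e)
        new-pair-respects {a} {b} ab∈ =
            mk⇔ (λ d<a → All.lookup e<above (imagesAbove⁺ ab∈ d<a)) e<b⇒d<a
          , mk⇔ (λ a<d → All.lookup below<e (imagesBelow⁺ ab∈ a<d)) b<e⇒a<d
          where
          e<b⇒d<a : R e b → R d a
          e<b⇒d<a e<b with compare d a
          ... | tri< d<a _ _ = d<a
          ... | tri≈ _ refl _ = ⊥-elim (d∉p (b , ab∈))
          ... | tri> _ _ a<d = ⊥-elim (asym (All.lookup below<e (imagesBelow⁺ ab∈ a<d)) e<b)
          b<e⇒a<d : R b e → R a d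
          b<e⇒a<d b<e with compare d a
          ... | tri< d<a _ _ = ⊥-elim (asym (All.lookup e<above (imagesAbove⁺ ab∈ d<a)) b<e)
          ... | tri≈ _ refl _ = ⊥-elim (d∉p (b , ab∈))
          ... | tri> _ _ a<d = a<d

        extend-respects : Respects R ((d , e) ∷ p)
        extend-respects (here refl) (here refl) =
          mk⇔ (λ d<d → ⊥-elim (irrefl refl d<d)) (λ e<e → ⊥-elim (irrefl refl e<e))
        extend-respects (here refl) (there ab∈) = proj₁ (new-pair-respects ab∈)
        extend-respects (there ab∈) (here refl) = proj₂ (new-pair-respects ab∈)
        extend-respects (there ab∈) (there ab'∈) = resp ab∈ ab'∈

  module O₁ = OneOrder isSTO₁
  module O₂ = OneOrder isSTO₂

  forth : ∀ p → IsPartialIso p → ∀ d → ∃ λ q → IsPartialIso q × p ⊆ q × d ∈dom q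
  forth p iso d with d ∈dom? p
  ... | yes d∈p = p , iso , (λ x∈ → x∈) , d∈p
  ... | no d∉p with extension (O₁.imagesBelow d p) (O₁.imagesAbove d p)
                              (O₂.imagesBelow d p) (O₂.imagesAbove d p)
                              (O₁.images-separated d (proj₁ iso)) (O₂.images-separated d (proj₂ iso))
  ...   | e , below<₁e , e<₁above , below<₂e , e<₂above =
          (d , e) ∷ p
        , ( O₁.extend-respects d (proj₁ iso) d∉p below<₁e e<₁above
          , O₂.extend-respects d (proj₂ iso) d∉p below<₂e e<₂above )
        , there , e , here refl

  record Refinement (p : PartialMap) (d : D) : Set where
    field
      q       : PartialMap
      iso     : IsPartialIso q
      extends : p ⊆ q
      in-dom  : d ∈dom q
      in-rng  : d ∈rng q

  back-and-forth : ∀ p → IsPartialIso p → ∀ d → Refinement p d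
  back-and-forth p iso d with forth p iso d
  ... | q₁ , iso₁ , p⊆q₁ , b , db∈q₁ with forth (inverse q₁) (inverse-iso iso₁) d
  ...   | q₂ , iso₂ , q₁⁻¹⊆q₂ , a , da∈q₂ = record
    { q       = inverse q₂
    ; iso     = inverse-iso iso₂
    ; extends = λ x∈p → ∈-map⁺ swap (q₁⁻¹⊆q₂ (∈-map⁺ swap (p⊆q₁ x∈p)))
    ; in-dom  = b , ∈-map⁺ swap (q₁⁻¹⊆q₂ (∈-map⁺ swap db∈q₁))
    ; in-rng  = a , ∈-map⁺ swap da∈q₂
    }

  module Limit (p₀ : PartialMap) (iso₀ : IsPartialIso p₀) where

    stage : ℕ → Σ PartialMap IsPartialIso
    refinement : ∀ n → Refinement (proj₁ (stage n)) (enum n)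

    stage zero = p₀ , iso₀
    stage (suc n) = Refinement.q (refinement n) , Refinement.iso (refinement n)
    refinement n = back-and-forth (proj₁ (stage n)) (proj₂ (stage n)) (enum n)

    pₙ : ℕ → PartialMap
    pₙ n = proj₁ (stage n)

    isoₙ : ∀ n → IsPartialIso (pₙ n)
    isoₙ n = proj₂ (stage n)

    stage-mono : ∀ k n → pₙ n ⊆ pₙ (k + n)
    stage-mono zero n x∈ = x∈
    stage-mono (suc k) n x∈ = Refinement.extends (refinement (k + n)) (stage-mono k n x∈)

    common-stage : ∀ {x y} n m → x ∈ pₙ n → y ∈ pₙ m → ∃ λ k → x ∈ pₙ k × y ∈ pₙ k
    common-stage {y = y} n m x∈ y∈ =
      m + n , stage-mono m n x∈ , subst (λ k → y ∈ pₙ k) (+-comm n m) (stage-mono n m y∈)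

    eventually-in-dom : ∀ d → ∃ λ n → d ∈dom pₙ n
    eventually-in-dom d with enum-surj d
    ... | n , refl = suc n , Refinement.in-dom (refinement n)

    eventually-in-rng : ∀ d → ∃ λ n → d ∈rng pₙ n
    eventually-in-rng d with enum-surj d
    ... | n , refl = suc n , Refinement.in-rng (refinement n)

    -- α is the union of the chain pₙ; enum n is in the domain and the range of pₙ₊₁.
    to from : D → D
    to d = proj₁ (proj₂ (eventually-in-dom d))
    from d = proj₁ (proj₂ (eventually-in-rng d))

    to-∈ : ∀ d → ∃ λ n → (d , to d) ∈ pₙ n
    to-∈ d = proj₁ (eventually-in-dom d) , proj₂ (proj₂ (eventually-in-dom d))

    from-∈ : ∀ d → ∃ λ n → (from d , d) ∈ pₙ n
    from-∈ d = proj₁ (eventually-in-rng d) , proj₂ (proj₂ (eventually-in-rng d))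

    to-from : ∀ d → to (from d) ≡ d
    to-from d with to-∈ (from d) | from-∈ d
    ... | n , ∈n | m , ∈m with common-stage n m ∈n ∈m
    ...   | k , ∈k , ∈k' = O₁.respects-functional (proj₁ (isoₙ k)) ∈k ∈k'

    from-to : ∀ d → from (to d) ≡ d
    from-to d with from-∈ (to d) | to-∈ d
    ... | n , ∈n | m , ∈m with common-stage n m ∈n ∈m
    ...   | k , ∈k , ∈k' = O₁.respects-injective (proj₁ (isoₙ k)) ∈k ∈k'

    α : Perm Π
    α = mk↔ₛ′ to from to-from from-to

    α-preserves : ∀ {R} → (∀ n → Respects R (pₙ n)) → Preserves Π R α
    α-preserves respₙ x y with to-∈ x | to-∈ y
    ... | n , ∈n | m , ∈m with common-stage n m ∈n ∈m
    ...   | k , ∈k , ∈k' = respₙ k ∈k ∈k'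

    α-extends : ∀ {a b} → (a , b) ∈ p₀ → to a ≡ b
    α-extends {a} ab∈ with to-∈ a
    ... | n , ∈n with common-stage n 0 ∈n ab∈
    ...   | k , ∈k , ∈k' = O₁.respects-functional (proj₁ (isoₙ k)) ∈k ∈k'

  homogeneous : ∀ p → IsPartialIso p →
                ∃ λ α → AutΠ Π α × (∀ {a b} → (a , b) ∈ p → app Π α a ≡ b)
  homogeneous p iso =
    α , (α-preserves (λ n → proj₁ (isoₙ n)) , α-preserves (λ n → proj₂ (isoₙ n))) , α-extends
    where open Limit p iso

Sends : ∀ {A : Set} → Dir → Rel A 0ℓ → Rel A 0ℓ → (A → A) → Set
Sends a R S g = ∀ {x y} → R x y → orient a S (g x) (g y)

module CanonicalImage (Π : RandomPermutation) where
  open RandomPermutation Π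
  module T₁ = Orientation isSTO₁
  module T₂ = Orientation isSTO₂

  ImageOrderSource : (D → D) → Rel D 0ℓ → Set
  ImageOrderSource g S = (∃ λ a → Sends a _<₁_ S g) ⊎ (∃ λ a → Sends a _<₂_ S g)

  sends⇒maps : ∀ a {R S : Rel D 0ℓ} {g : D → D} → Sends a R S g → Maps Π a R S g
  sends⇒maps idD s _ _ r = s r
  sends⇒maps revD s _ _ r = s r

  pair-of-type : ∀ d → ∃₂ λ x y → x <₁ y × orient d _<₂_ x y
  pair-of-type idD with extension (enum 0 ∷ []) [] (enum 0 ∷ []) [] (λ _ ()) (λ _ ())
  ... | y , x<₁y ∷ [] , _ , x<₂y ∷ [] , _ = enum 0 , y , x<₁y , x<₂y
  pair-of-type revD with extension (enum 0 ∷ []) [] [] (enum 0 ∷ []) (λ _ ()) (λ ())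
  ... | y , x<₁y ∷ [] , _ , _ , y<₂x ∷ [] = enum 0 , y , x<₁y , y<₂x

  same-type : ∀ d {x y x' y'} → x <₁ y → orient d _<₂_ x y → x' <₁ y' → orient d _<₂_ x' y' →
              SameType Π x y x' y'
  same-type d x<₁y r₂ x'<₁y' r₂' =
      mk⇔ (⊥-elim ∘′ T₁.orient-≢ idD x<₁y) (⊥-elim ∘′ T₁.orient-≢ idD x'<₁y')
    , T₁.orient-⇔ idD x<₁y x'<₁y'
    , T₂.orient-⇔ d r₂ r₂'

  module _ {g : D → D} (can : Canonical Π g) (g-injective : ∀ {x y} → g x ≡ g y → x ≡ y)
           {S : Rel D 0ℓ} (stoS : IsStrictTotalOrder _≡_ S)
           (S-of-type : ∀ {x y x' y'} → SameType Π x y x' y' → S x y ⇔ S x' y') where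
    module TS = Orientation stoS

    SendsType : Dir → Dir → Set
    SendsType d e = ∀ {x y} → x <₁ y → orient d _<₂_ x y → orient e S (g x) (g y)

    -- Canonicity makes the orientation constant on each type, so it is read off a witness pair.
    type-orientation : ∀ d → ∃ λ e → SendsType d e
    type-orientation d with pair-of-type d
    ... | _ , _ , x'<₁y' , r₂' with TS.orientation (T₁.orient-≢ idD x'<₁y' ∘′ g-injective)
    ...   | e , image' = e , λ x<₁y r₂ →
            let t = can _ _ _ _ (same-type d x<₁y r₂ x'<₁y' r₂')
            in TS.orient-transfer e (proj₁ t) (S-of-type t) image'

    sends-from-<₁ : ∀ a → SendsType idD a → SendsType revD a → Sends a _<₁_ S g
    sends-from-<₁ _ up twist x<₁y with T₂.orientation (T₁.orient-≢ idD x<₁y)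
    ... | idD , x<₂y = up x<₁y x<₂y
    ... | revD , y<₂x = twist x<₁y y<₂x

    sends-from-<₂ : ∀ a → SendsType idD a → SendsType revD (flipDir a) → Sends a _<₂_ S g
    sends-from-<₂ a up twist x<₂y with T₁.orientation (T₂.orient-≢ idD x<₂y)
    ... | idD , x<₁y = up x<₁y x<₂y
    ... | revD , y<₁x = orient-unflip a (twist y<₁x x<₂y)

    image-order-source : ImageOrderSource g S
    image-order-source with type-orientation idD | type-orientation revD
    ... | idD , up | idD , twist = inj₁ (idD , sends-from-<₁ idD up twist)
    ... | revD , up | revD , twist = inj₁ (revD , sends-from-<₁ revD up twist)
    ... | idD , up | revD , twist = inj₂ (idD , sends-from-<₂ idD up twist)
    ... | revD , up | idD , twist = inj₂ (revD , sends-from-<₂ revD up twist)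

module ImageConsequences (Π : RandomPermutation) where
  open RandomPermutation Π
  module STO₁ = IsStrictTotalOrder isSTO₁
  module STO₂ = IsStrictTotalOrder isSTO₂

  st-sym : Symmetric (st Π)
  st-sym (inj₁ u) = inj₂ u
  st-sym (inj₂ u) = inj₁ u

  tw-sym : Symmetric (tw Π)
  tw-sym t s = t (st-sym s)

  module _ {R : Rel D 0ℓ} (stoR : IsStrictTotalOrder _≡_ R) {g : D → D} where
    open IsStrictTotalOrder stoR using (compare)

    on-image : ∀ {P : Rel D 0ℓ} → Symmetric P → (∀ {x y} → R x y → P (g x) (g y)) →
               ∀ x y → g x ≢ g y → P (g x) (g y)
    on-image P-sym P-img x y gx≢gy with compare x y
    ... | tri< x<y _ _ = P-img x<y
    ... | tri≈ _ x≡y _ = ⊥-elim (gx≢gy (cong g x≡y))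
    ... | tri> _ _ y<x = P-sym (P-img y<x)

    straight-image : ∀ d → Sends d R _<₁_ g → Sends d R _<₂_ g → ∀ {x y} → R x y → st Π (g x) (g y)
    straight-image idD s₁ s₂ r = inj₁ (s₁ r , s₂ r)
    straight-image revD s₁ s₂ r = inj₂ (s₁ r , s₂ r)

    twisted-image : ∀ d → Sends d R _<₁_ g → Sends (flipDir d) R _<₂_ g →
                    ∀ {x y} → R x y → tw Π (g x) (g y)
    twisted-image idD s₁ s₂ r (inj₁ (_ , gx<₂gy)) = STO₂.asym gx<₂gy (s₂ r)
    twisted-image idD s₁ s₂ r (inj₂ (gy<₁gx , _)) = STO₁.asym (s₁ r) gy<₁gx
    twisted-image revD s₁ s₂ r (inj₁ (gx<₁gy , _)) = STO₁.asym gx<₁gy (s₁ r)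
    twisted-image revD s₁ s₂ r (inj₂ (_ , gy<₂gx)) = STO₂.asym (s₂ r) gy<₂gx

    diagonal-image : ∀ a b → Sends a R _<₁_ g → Sends b R _<₂_ g → DiagonalImage Π g
    diagonal-image idD idD s₁ s₂ = inj₁ (on-image {P = st Π} st-sym (straight-image idD s₁ s₂))
    diagonal-image revD revD s₁ s₂ = inj₁ (on-image {P = st Π} st-sym (straight-image revD s₁ s₂))
    diagonal-image idD revD s₁ s₂ = inj₂ (on-image {P = tw Π} tw-sym (twisted-image idD s₁ s₂))
    diagonal-image revD idD s₁ s₂ = inj₂ (on-image {P = tw Π} tw-sym (twisted-image revD s₁ s₂))

    module _ {S : Rel D 0ℓ} (stoS : IsStrictTotalOrder _≡_ S) where
      open Orientation stoS using (orient-⇔)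
      open IsStrictTotalOrder stoS using (irrefl)

      image-⇔ : ∀ c → Sends c R S g →
                ∀ {x y x' y'} → (x ≡ y ⇔ x' ≡ y') → (R x y ⇔ R x' y') → (R y x ⇔ R y' x') →
                S (g x) (g y) ⇔ S (g x') (g y')
      image-⇔ c s {x} {y} ≡⇔ R⇔ R⁻¹⇔ with compare x y
      ... | tri< x<y _ _ = orient-⇔ c (s x<y) (s (Equivalence.to R⇔ x<y))
      ... | tri≈ _ refl _ = mk⇔ (λ gx<gx → ⊥-elim (irrefl refl gx<gx))
                                (λ gx'<gy' → ⊥-elim (irrefl (cong g (Equivalence.to ≡⇔ refl)) gx'<gy'))
      ... | tri> _ _ y<x =
        orient-⇔ (flipDir c) (orient-flip c (s y<x)) (orient-flip c (s (Equivalence.to R⁻¹⇔ y<x)))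

module ClosedGroup (Π : RandomPermutation) (G : Perm Π → Set) (isG : IsClosedPermGroup Π G)
                   (Aut⊆G : ∀ π → AutΠ Π π → G π) where
  open RandomPermutation Π
  open IsClosedPermGroup isG
  open Homogeneity Π using (IsPartialIso; homogeneous)
  open ImageConsequences Π using (image-⇔)

  compose-∈ : ∀ σs → All G σs → ∃ λ s → G s × (∀ x → app Π s x ≡ compose Π σs x)
  compose-∈ [] [] = ↔-id D , id-∈ (↔-id D) (λ _ → refl) , λ _ → refl
  compose-∈ (σ ∷ σs) (σ∈G ∷ σs∈G) with compose-∈ σs σs∈G
  ... | s , s∈G , s≗ =
    σ ↔-∘ s , comp-∈ (σ ↔-∘ s) σ s σ∈G s∈G (λ _ → refl) , λ x → cong (app Π σ) (s≗ x)

  module _ {g : D → D} (mg : MonGenerated Π G g) where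

    local-permutation : ∀ A → ∃ λ s → G s × (∀ {x} → x ∈ A → app Π s x ≡ g x)
    local-permutation A with mg A
    ... | σs , σs∈G , g≗σs with compose-∈ σs σs∈G
    ...   | s , s∈G , s≗σs = s , s∈G , λ {x} x∈A → trans (s≗σs x) (sym (All.lookup g≗σs x∈A))

    mon-generated-injective : ∀ {x y} → g x ≡ g y → x ≡ y
    mon-generated-injective {x} {y} gx≡gy with local-permutation (x ∷ y ∷ [])
    ... | s , _ , s≗g = Injection.injective (↔⇒↣ s) (begin
      app Π s x  ≡⟨ s≗g (here refl) ⟩
      g x        ≡⟨ gx≡gy ⟩
      g y        ≡⟨ sym (s≗g (there (here refl))) ⟩
      app Π s y  ∎)
      where open ≡-Reasoning

    module _ {R : Rel D 0ℓ} (stoR : IsStrictTotalOrder _≡_ R) (a b : Dir)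
             (s₁ : Sends a R _<₁_ g) (s₂ : Sends b R _<₂_ g) where

      image-pairs-iso : ∀ π → Preserves Π R π → ∀ A → IsPartialIso (map (λ x → g x , g (app Π π x)) A)
      image-pairs-iso π π-pres A = respects isSTO₁ a s₁ , respects isSTO₂ b s₂
        where
        π-injective : ∀ {x y} → app Π π x ≡ app Π π y → x ≡ y
        π-injective = Injection.injective (↔⇒↣ π)
        respects : ∀ {S} → IsStrictTotalOrder _≡_ S → ∀ c → Sends c R S g →
                   Homogeneity.Respects Π S (map (λ x → g x , g (app Π π x)) A)
        respects stoS c s xy∈ x'y'∈ with ∈-map⁻ _ xy∈ | ∈-map⁻ _ x'y'∈
        ... | x , _ , refl | x' , _ , refl =
          image-⇔ stoR stoS c s (mk⇔ (cong (app Π π)) π-injective) (π-pres x x') (π-pres x' x)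

      aut-subset : AutSubset Π R G
      aut-subset π π-pres = closed π approximation
        where
        approximation : ∀ A → ∃ λ σ → G σ × AgreeOn Π A (app Π π) (app Π σ)
        approximation A with local-permutation (A ++ map (app Π π) A)
        ... | s , s∈G , s≗g with homogeneous _ (image-pairs-iso π π-pres A)
        ...   | α , α-aut , α-extends =
                ↔-sym s ↔-∘ (α ↔-∘ s)
              , comp-∈ _ (↔-sym s) (α ↔-∘ s) (inv-∈ s s∈G)
                       (comp-∈ _ α s (Aut⊆G α α-aut) s∈G (λ _ → refl)) (λ _ → refl)
              , All.tabulate agrees
          where
          agrees : ∀ {x} → x ∈ A → app Π π x ≡ Inverse.from s (app Π α (app Π s x))
          agrees {x} x∈A = sym (begin
            Inverse.from s (app Π α (app Π s x)) ≡⟨ cong (Inverse.from s ∘′ app Π α) (s≗g (∈-++⁺ˡ x∈A)) ⟩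
            Inverse.from s (app Π α (g x))       ≡⟨ cong (Inverse.from s) (α-extends (∈-map⁺ _ x∈A)) ⟩
            Inverse.from s (g (app Π π x))       ≡⟨ cong (Inverse.from s) (sym (s≗g (∈-++⁺ʳ A (∈-map⁺ _ x∈A)))) ⟩
            Inverse.from s (app Π s (app Π π x)) ≡⟨ Inverse.strictlyInverseʳ s (app Π π x) ⟩
            app Π π x                            ∎)
            where open ≡-Reasoning

module _ (Π : RandomPermutation) where
  open RandomPermutation Π

  BehavesLikeOneOfEight : (D → D) → Set
  BehavesLikeOneOfEight g =
      BehavesLike Π idD idD g ⊎ BehavesLike Π idD revD g
    ⊎ BehavesLike Π revD idD g ⊎ BehavesLike Π revD revD g
    ⊎ BehavesLikeSw Π idD idD g ⊎ BehavesLikeSw Π revD revD g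
    ⊎ BehavesLikeSw Π idD revD g ⊎ BehavesLikeSw Π revD idD g

  behavesLike⇒oneOfEight : ∀ a b {g} → BehavesLike Π a b g → BehavesLikeOneOfEight g
  behavesLike⇒oneOfEight idD idD bl = inj₁ bl
  behavesLike⇒oneOfEight idD revD bl = inj₂ (inj₁ bl)
  behavesLike⇒oneOfEight revD idD bl = inj₂ (inj₂ (inj₁ bl))
  behavesLike⇒oneOfEight revD revD bl = inj₂ (inj₂ (inj₂ (inj₁ bl)))

  behavesLikeSw⇒oneOfEight : ∀ a b {g} → BehavesLikeSw Π a b g → BehavesLikeOneOfEight g
  behavesLikeSw⇒oneOfEight idD idD bl = inj₂ (inj₂ (inj₂ (inj₂ (inj₁ bl))))
  behavesLikeSw⇒oneOfEight revD revD bl = inj₂ (inj₂ (inj₂ (inj₂ (inj₂ (inj₁ bl)))))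
  behavesLikeSw⇒oneOfEight idD revD bl = inj₂ (inj₂ (inj₂ (inj₂ (inj₂ (inj₂ (inj₁ bl))))))
  behavesLikeSw⇒oneOfEight revD idD bl = inj₂ (inj₂ (inj₂ (inj₂ (inj₂ (inj₂ (inj₂ bl))))))

proposition3p3 : (Π : RandomPermutation) →
    let open RandomPermutation Π in
    (G : Perm Π → Set) → IsClosedPermGroup Π G → (∀ π → AutΠ Π π → G π) →
    (g : D → D) → Canonical Π g → MonGenerated Π G g →
    (DiagonalImage Π g × (AutSubset Π _<₁_ G ⊎ AutSubset Π _<₂_ G))
    ⊎ (BehavesLike Π idD idD g ⊎ BehavesLike Π idD revD g
       ⊎ BehavesLike Π revD idD g ⊎ BehavesLike Π revD revD g
       ⊎ BehavesLikeSw Π idD idD g ⊎ BehavesLikeSw Π revD revD g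
       ⊎ BehavesLikeSw Π idD revD g ⊎ BehavesLikeSw Π revD idD g)
proposition3p3 Π G isG Aut⊆G g can mg =
  classify (image-order-source can g-injective isSTO₁ (proj₁ ∘′ proj₂))
           (image-order-source can g-injective isSTO₂ (proj₂ ∘′ proj₂))
  where
  open RandomPermutation Π
  open CanonicalImage Π
  open ImageConsequences Π using (diagonal-image)
  open ClosedGroup Π G isG Aut⊆G

  g-injective : ∀ {x y} → g x ≡ g y → x ≡ y
  g-injective = mon-generated-injective mg

  classify : ImageOrderSource g _<₁_ → ImageOrderSource g _<₂_ →
             (DiagonalImage Π g × (AutSubset Π _<₁_ G ⊎ AutSubset Π _<₂_ G)) ⊎ BehavesLikeOneOfEight Π g
  classify (inj₁ (a , s₁)) (inj₁ (b , s₂)) =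
    inj₁ (diagonal-image isSTO₁ a b s₁ s₂ , inj₁ (aut-subset mg isSTO₁ a b s₁ s₂))
  classify (inj₂ (a , s₁)) (inj₂ (b , s₂)) =
    inj₁ (diagonal-image isSTO₂ a b s₁ s₂ , inj₂ (aut-subset mg isSTO₂ a b s₁ s₂))
  classify (inj₁ (a , s₁)) (inj₂ (b , s₂)) =
    inj₂ (behavesLike⇒oneOfEight Π a b (sends⇒maps a s₁ , sends⇒maps b s₂))
  classify (inj₂ (a , s₁)) (inj₁ (b , s₂)) =
    inj₂ (behavesLikeSw⇒oneOfEight Π b a (sends⇒maps b s₂ , sends⇒maps a s₁))
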